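{- Let $q$ be a prime power, $n\geq1$, $\sigma\in\mathrm{Aut}(\mathbb F_q)$. The set of weights of the codewords of $\mathcal C(\Lambda_\sigma)$ is \[\left\{q^{n-1}\frac{q^{n+1}-1}{q-1}-q^{n-1}\theta_M : M\in M_{n+1}(q)\right\},\] the codeword $c_M$ having weight $q^{n-1}\frac{q^{n+1}-1}{q-1}-q^{n-1}\theta_M$.
   Context: $V=\mathbb F_q^{n+1}$ (column vectors), $V^*$ row vectors; $A^\sigma$ means $\sigma$ applied entrywise. $\Lambda_\sigma=\{[x^\sigma\xi]: x\in V\setminus\{0\},\xi\in V^*\setminus\{0\},\xi x=0\}\subseteq\mathrm{PG}(M_{n+1}(q))$ with representatives $X_1,\dots,X_N$; $\mathcal C(\Lambda_\sigma)=\{c_M\}$, $c_M=(\mathrm{Tr}(X_1M),\dots,\mathrm{Tr}(X_NM))$. $\theta_M$ is the number of points $[\xi]\in\mathrm{PG}(V^*)$ with $\ker(\xi^\sigma)\subseteq\ker(\xi M)$ (the kernel of the zero functional being $V$). -}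

module Defs where

open import Level using (0ℓ)
import Data.Nat as ℕ
open import Data.Nat using (ℕ; zero; suc; NonZero; _∸_; _^_)
import Data.Nat.Properties as ℕP
import Data.Nat.DivMod
open import Data.Fin as Fin using (Fin)
open import Data.Fin.Properties using () renaming (all? to finAll?)
open import Data.List as List using (List; []; _∷_; length; filter; cartesianProductWith; allFin)
open import Data.List.Membership.Propositional using (_∈_)
open import Data.List.Membership.Propositional.Properties
  using (∈-map⁺; ∈-cartesianProductWith⁺; ∈-allFin)
open import Data.List.Relation.Unary.Any as Any using (Any; here; there; any?)
open import Data.List.Relation.Unary.All as All using (All; all?)
open import Data.Vec as Vec using (Vec; []; _∷_; replicate; foldr; zipWith; concat; map)
open import Data.Vec.Properties using (≡-dec)
open import Data.Product using (Σ; Σ-syntax; ∃; _×_; _,_; proj₁; proj₂)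
open import Data.Sum using (_⊎_; inj₁; inj₂)
open import Data.Empty using (⊥)
open import Function using (_∘_; _↔_; Inverse)
open import Relation.Nullary using (Dec; yes; no; ¬_; ¬?)
open import Relation.Nullary.Decidable using (map′; _×-dec_; _⊎-dec_)
open import Relation.Binary.Definitions using (DecidableEquality)
open import Relation.Binary.PropositionalEquality
  using (_≡_; _≢_; refl; sym; trans; cong; cong₂)
open import Algebra.Structures using (IsCommutativeRing)

record FiniteField : Set₁ where
  field
    Carrier : Set
    _+_ _*_ : Carrier → Carrier → Carrier
    -_      : Carrier → Carrier
    0# 1#   : Carrier
    isCommutativeRing : IsCommutativeRing _≡_ _+_ _*_ -_ 0# 1#
    0≢1     : 0# ≢ 1#
    inverse : ∀ x → x ≢ 0# → Σ[ y ∈ Carrier ] (x * y ≡ 1#)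
    _≟_     : DecidableEquality Carrier
    size    : ℕ
    enum    : Fin size ↔ Carrier

record Automorphism (F : FiniteField) : Set where
  open FiniteField F
  field
    σ        : Carrier → Carrier
    σ-+      : ∀ x y → σ (x + y) ≡ σ x + σ y
    σ-*      : ∀ x y → σ (x * y) ≡ σ x * σ y
    σ-1      : σ 1# ≡ 1#
    σ⁻¹      : Carrier → Carrier
    σ-σ⁻¹    : ∀ x → σ (σ⁻¹ x) ≡ x
    σ⁻¹-σ    : ∀ x → σ⁻¹ (σ x) ≡ x

module _ (F : FiniteField) where
  open FiniteField F

  q : ℕ
  q = size

  elems : List Carrier
  elems = List.map (Inverse.to enum) (allFin size)

  elems-complete : ∀ x → x ∈ elems
  elems-complete x with ∈-map⁺ (Inverse.to enum) (∈-allFin (Inverse.from enum x))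
  ... | p rewrite Inverse.strictlyInverseˡ enum x = p

  allVecs : (k : ℕ) → List (Vec Carrier k)
  allVecs zero    = [] ∷ []
  allVecs (suc k) = cartesianProductWith _∷_ elems (allVecs k)

  allVecs-complete : ∀ {k} (v : Vec Carrier k) → v ∈ allVecs k
  allVecs-complete []      = here refl
  allVecs-complete (a ∷ v) =
    ∈-cartesianProductWith⁺ _∷_ (elems-complete a) (allVecs-complete v)

  allRows : (k m : ℕ) → List (Vec (Vec Carrier k) m)
  allRows k zero    = [] ∷ []
  allRows k (suc m) = cartesianProductWith _∷_ (allVecs k) (allRows k m)

  -- all (n+1)×(n+1) matrices, as vectors of rows
  allMats : (k : ℕ) → List (Vec (Vec Carrier k) k)
  allMats k = allRows k k


  allMats-complete : ∀ {k} (A : Vec (Vec Carrier k) k) → A ∈ allMats k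
  allMats-complete {k} A = go A
    where
    go : ∀ {m} (B : Vec (Vec Carrier k) m) → B ∈ allRows k m
    go []      = here refl
    go (r ∷ B) = ∈-cartesianProductWith⁺ _∷_ (allVecs-complete r) (go B)

  ∃? : ∀ {k} (P : Vec Carrier k → Set) → (∀ v → Dec (P v)) → Dec (Σ[ v ∈ Vec Carrier k ] P v)
  ∃? {k} P P? = map′ to from (any? P? (allVecs k))
    where
    to : Any P (allVecs k) → Σ _ P
    to a = Any.satisfied a
    from : Σ _ P → Any P (allVecs k)
    from (v , p) = Any.map (λ { refl → p }) (allVecs-complete v)

  ∀? : ∀ {k} (P : Vec Carrier k → Set) → (∀ v → Dec (P v)) → Dec (∀ v → P v)
  ∀? {k} P P? = map′ (λ a v → All.lookup a (allVecs-complete v)) (λ f → All.tabulate (λ {v} _ → f v))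
                     (all? P? (allVecs k))

  ∃∈? : (P : Carrier → Set) → (∀ c → Dec (P c)) → Dec (Σ[ c ∈ Carrier ] P c)
  ∃∈? P P? = map′ Any.satisfied (λ { (c , p) → Any.map (λ { refl → p }) (elems-complete c) })
                  (any? P? elems)

  count : {A : Set} {P : A → Set} → (∀ a → Dec (P a)) → List A → ℕ
  count P? xs = length (filter P? xs)

  Vect : ℕ → Set
  Vect k = Vec Carrier k

  Mat : ℕ → Set
  Mat k = Vec (Vec Carrier k) k

  zeroV : ∀ {k} → Vect k
  zeroV = replicate _ 0#

  zeroM : ∀ {k} → Mat k
  zeroM = replicate _ zeroV

  sumV : ∀ {k} → Vect k → Carrier
  sumV = foldr _ _+_ 0#

  _·_ : ∀ {k} → Vect k → Vect k → Carrier
  ξ · x = sumV (zipWith _*_ ξ x)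

  column : ∀ {k} → Mat k → Fin k → Vect k
  column A j = map (λ row → Vec.lookup row j) A

  _⊗_ : ∀ {k} → Mat k → Mat k → Mat k
  A ⊗ B = map (λ row → Vec.tabulate (λ j → row · column B j)) A

  _⟨_⟩ : ∀ {k} → Vect k → Mat k → Vect k
  ξ ⟨ M ⟩ = Vec.tabulate (λ j → ξ · column M j)

  trace : ∀ {k} → Mat k → Carrier
  trace A = sumV (Vec.tabulate (λ i → Vec.lookup (Vec.lookup A i) i))

  outer : ∀ {k} → Vect k → Vect k → Mat k
  outer x ξ = map (λ a → map (a *_) ξ) x

  scaleM : ∀ {k} → Carrier → Mat k → Mat k
  scaleM c = map (map (c *_))

  -- Projective points: each point of PG(F^m) is represented by the
  -- unique nonzero vector whose first nonzero entry equals 1.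

  Normalized : ∀ {m} → Vect m → Set
  Normalized []      = ⊥
  Normalized (a ∷ v) = (a ≡ 0# × Normalized v) ⊎ (a ≡ 1#)

  normalized? : ∀ {m} (v : Vect m) → Dec (Normalized v)
  normalized? []      = no λ ()
  normalized? (a ∷ v) = ((a ≟ 0#) ×-dec normalized? v) ⊎-dec (a ≟ 1#)

  -- matrices as points of PG(M_{k}(q)): first nonzero entry (row-major) is 1
  NormalizedM : ∀ {k} → Mat k → Set
  NormalizedM A = Normalized (concat A)

  module _ (Aut : Automorphism F) where
    open Automorphism Aut

    _^σ : ∀ {k} → Vect k → Vect k
    v ^σ = map σ v

    -- X is (a representative of) the projective point [x^σ ξ] for some
    -- nonzero x ∈ V, nonzero ξ ∈ V* with ξ x = 0.
    InΛ : ∀ {k} → Mat k → Set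
    InΛ {k} X = Σ[ x ∈ Vect k ] Σ[ ξ ∈ Vect k ]
                  (x ≢ zeroV) × (ξ ≢ zeroV) × (ξ · x ≡ 0#) ×
                  (Σ[ c ∈ Carrier ] (c ≢ 0#) × (X ≡ scaleM c (outer (x ^σ) ξ)))

    inΛ? : ∀ {k} (X : Mat k) → Dec (InΛ X)
    inΛ? {k} X =
      ∃? _ λ x → ∃? _ λ ξ →
        ¬? (≡-dec _≟_ x zeroV) ×-dec ¬? (≡-dec _≟_ ξ zeroV) ×-dec ((ξ · x) ≟ 0#) ×-dec
        ∃∈? _ (λ c → ¬? (c ≟ 0#) ×-dec ≡-dec (≡-dec _≟_) X (scaleM c (outer (x ^σ) ξ)))

    -- the points of Λ_σ ⊆ PG(M_{n+1}(q)), via normalized representatives X_1,…,X_N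
    ΛPoint : ∀ {k} → Mat k → Set
    ΛPoint X = NormalizedM X × InΛ X

    Λpoints : (n : ℕ) → List (Mat (suc n))
    Λpoints n = filter (λ X → normalized? (concat X) ×-dec inΛ? X) (allMats (suc n))

    codeword : (n : ℕ) → Mat (suc n) → List Carrier
    codeword n M = List.map (λ X → trace (X ⊗ M)) (Λpoints n)

    weight : List Carrier → ℕ
    weight c = count (λ a → ¬? (a ≟ 0#)) c

    KerCond : ∀ {k} → Mat k → Vect k → Set
    KerCond M ξ = ∀ x → (ξ ^σ) · x ≡ 0# → (ξ ⟨ M ⟩) · x ≡ 0#

    kerCond? : ∀ {k} (M : Mat k) (ξ : Vect k) → Dec (KerCond M ξ)
    kerCond? M ξ = ∀? _ (λ x → decImp (((ξ ^σ) · x) ≟ 0#) (((ξ ⟨ M ⟩) · x) ≟ 0#))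
      where
      decImp : ∀ {A B : Set} → Dec A → Dec B → Dec (A → B)
      decImp _       (yes b) = yes (λ _ → b)
      decImp (no ¬a) _       = yes (λ a → Data.Empty.⊥-elim (¬a a))
        where import Data.Empty
      decImp (yes a) (no ¬b) = no (λ f → ¬b (f a))

    θ : (n : ℕ) → Mat (suc n) → ℕ
    θ n M = count (λ ξ → normalized? ξ ×-dec kerCond? M ξ) (allVecs (suc n))

  -- q - 1 ≠ 0 (a field has at least two elements)

  q∸1-nonZero : NonZero (q ∸ 1)
  q∸1-nonZero with size | enum
  ... | zero  | e = Data.Empty.⊥-elim (go (Inverse.from e 0#))
    where import Data.Empty
          go : Fin 0 → ⊥
          go ()
  ... | suc zero | e = Data.Empty.⊥-elim (0≢1 (trans (sym (Inverse.strictlyInverseˡ e 0#))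
                         (trans (cong (Inverse.to e) (fin1 _ _)) (Inverse.strictlyInverseˡ e 1#))))
    where import Data.Empty
          fin1 : (a b : Fin 1) → a ≡ b
          fin1 Fin.zero Fin.zero = refl
  ... | suc (suc k) | e = _


weightFormula : (F : FiniteField) → ℕ → ℕ → ℕ
weightFormula F n θM =
  q F ^ (n ∸ 1) ℕ.* (Data.Nat.DivMod._/_ (q F ^ (suc n) ∸ 1) (q F ∸ 1) {{q∸1-nonZero F}}) ∸ q F ^ (n ∸ 1) ℕ.* θM

{-# OPTIONS --safe #-}
module Submission where

-- Every point of Λ_σ is [y ξ] for unique normalized y ∈ V, ξ ∈ V* with ξ^σ y = 0 (take y = x^σ),
-- and Tr(y ξ M) = (ξ M) y.  Hence the weight of c_M is the number of pairs ([ξ], [y]) with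
-- ξ^σ y = 0 and (ξ M) y ≠ 0.  For a fixed [ξ] there are none if ker(ξ^σ) ⊆ ker(ξ M); otherwise
-- ξ^σ and ξ M are linearly independent and the points of the hyperplane ker(ξ^σ) outside ker(ξ M)
-- form an affine space with q^(n-1) points.  Summing over the (q^(n+1)-1)/(q-1) - θ_M remaining
-- points [ξ] gives the weight.  Every count is an explicit bijection between duplicate-free lists.

open import Defs
open import Data.Nat using (ℕ; suc; _≤_)
open import Data.Product using (Σ-syntax; _×_)
open import Function.Bundles using (_⇔_)
open import Relation.Binary.PropositionalEquality using (_≡_)

open import Algebra.Bundles using (CommutativeRing)
import Algebra.Properties.Ring as RingProperties
import Data.Nat as ℕ
open import Data.Nat using (zero; _∸_; _^_; NonZero)
import Data.Nat.Properties as ℕ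
open import Data.Nat.DivMod using (_/_; /-congˡ; /-congʳ; m*n/n≡m)
open import Data.List using (List; []; _∷_; _++_; length; filter; map; allFin; cartesianProduct; cartesianProductWith)
import Data.List.Properties as List
open import Data.List.Membership.Propositional using (_∈_)
open import Data.List.Membership.Propositional.Properties
  using (∈-map⁺; ∈-map⁻; ∈-filter⁺; ∈-filter⁻; ∈-cartesianProduct⁺; ∈-cartesianProduct⁻)
open import Data.List.Membership.Propositional.Properties.WithK using (unique∧set⇒bag)
open import Data.List.Relation.Binary.BagAndSetEquality using (∼bag⇒↭)
open import Data.List.Relation.Binary.Permutation.Propositional.Properties using (↭-length)
open import Data.List.Relation.Unary.All as All using (All; []; _∷_)
open import Data.List.Relation.Unary.Any using (here; there)
open import Data.List.Relation.Unary.Unique.Propositional using (Unique; []; _∷_)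
import Data.List.Relation.Unary.Unique.Propositional.Properties as Unique
open import Data.Product using (∃-syntax; _,_; proj₁; proj₂)
open import Data.Sum using (inj₁; inj₂)
open import Data.Vec as Vec using (Vec; []; _∷_; concat)
import Data.Vec.Properties as Vec
open import Data.Vec.Properties using (≡-dec)
open import Function using (_∘_; mk⇔; Inverse; Injection)
open import Function.Properties.Inverse using (↔⇒↣)
open import Level using (0ℓ)
open import Relation.Binary.Definitions using (DecidableEquality)
open import Relation.Binary.PropositionalEquality
  using (_≢_; refl; sym; trans; cong; cong₂; subst; ≢-sym; module ≡-Reasoning)
open import Relation.Nullary using (Dec; yes; no; ¬_; ¬?; contradiction)
open import Relation.Nullary.Decidable using (_×-dec_; decidable-stable)

module Counting where
  open ≡-Reasoning

  private variable
    A B C : Set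

  Unique-map⁺ : {f : A → B} {xs : List A} → Unique xs →
    (∀ {x y} → x ∈ xs → y ∈ xs → f x ≡ f y → x ≡ y) → Unique (map f xs)
  Unique-map⁺ {xs = []} _ _ = []
  Unique-map⁺ {f = f} {xs = x ∷ xs} (x∉xs ∷ !xs) inj =
    distinct x∉xs (λ y∈xs → y∈xs) ∷ Unique-map⁺ !xs (λ p q → inj (there p) (there q))
    where
    distinct : ∀ {ys} → All (x ≢_) ys → (∀ {y} → y ∈ ys → y ∈ xs) → All (f x ≢_) (map f ys)
    distinct []         _   = []
    distinct (x≢y ∷ ps) sub =
      (x≢y ∘ inj (here refl) (there (sub (here refl)))) ∷ distinct ps (sub ∘ there)

  bijection⇒length≡ : {xs : List A} {ys : List B} → Unique xs → Unique ys → (f : A → B) →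
    (∀ {x} → x ∈ xs → f x ∈ ys) →
    (∀ {x x′} → x ∈ xs → x′ ∈ xs → f x ≡ f x′ → x ≡ x′) →
    (∀ {y} → y ∈ ys → ∃[ x ] x ∈ xs × f x ≡ y) →
    length xs ≡ length ys
  bijection⇒length≡ {xs = xs} {ys = ys} !xs !ys f into inj onto = begin
    length xs
      ≡⟨ List.length-map f xs ⟨
    length (map f xs)
      ≡⟨ ↭-length (∼bag⇒↭ (unique∧set⇒bag (Unique-map⁺ !xs inj) !ys (mk⇔ ⊆ys ⊇ys))) ⟩
    length ys ∎
    where
    ⊆ys : ∀ {y} → y ∈ map f xs → y ∈ ys
    ⊆ys y∈ with _ , x∈ , refl ← ∈-map⁻ f y∈ = into x∈
    ⊇ys : ∀ {y} → y ∈ ys → y ∈ map f xs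
    ⊇ys y∈ with _ , x∈ , refl ← onto y∈ = ∈-map⁺ f x∈

  length-cartesianProductWith : (f : A → B → C) (xs : List A) (ys : List B) →
    length (cartesianProductWith f xs ys) ≡ length xs ℕ.* length ys
  length-cartesianProductWith f []       ys = refl
  length-cartesianProductWith f (x ∷ xs) ys = trans (List.length-++ (map (f x) ys))
    (cong₂ ℕ._+_ (List.length-map (f x) ys) (length-cartesianProductWith f xs ys))

  length-filter-map : {P : B → Set} (P? : ∀ y → Dec (P y)) (f : A → B) (xs : List A) →
    length (filter P? (map f xs)) ≡ length (filter (P? ∘ f) xs)
  length-filter-map P? f []       = refl
  length-filter-map P? f (x ∷ xs) with P? (f x)
  ... | yes _ = cong suc (length-filter-map P? f xs)
  ... | no  _ = length-filter-map P? f xs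

  module _ {P : A → Set} {R : A × B → Set} (P? : ∀ x → Dec (P x)) (R? : ∀ p → Dec (R p))
           (ys : List B) (c : ℕ)
           (fibre-P : ∀ x → P x → length (filter (R? ∘ (x ,_)) ys) ≡ c)
           (fibre-¬P : ∀ x → ¬ P x → length (filter (R? ∘ (x ,_)) ys) ≡ 0) where

    length-filter-cartesianProduct : ∀ xs → length (filter R? (cartesianProduct xs ys)) ≡ c ℕ.* length (filter P? xs)
    length-filter-cartesianProduct []       = sym (ℕ.*-zeroʳ c)
    length-filter-cartesianProduct (x ∷ xs) = begin
      length (filter R? (map (x ,_) ys ++ cartesianProduct xs ys))
        ≡⟨ cong length (List.filter-++ R? (map (x ,_) ys) (cartesianProduct xs ys)) ⟩
      length (filter R? (map (x ,_) ys) ++ filter R? (cartesianProduct xs ys))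
        ≡⟨ List.length-++ (filter R? (map (x ,_) ys)) ⟩
      length (filter R? (map (x ,_) ys)) ℕ.+ length (filter R? (cartesianProduct xs ys))
        ≡⟨ cong₂ ℕ._+_ (length-filter-map R? (x ,_) ys) (length-filter-cartesianProduct xs) ⟩
      length (filter (R? ∘ (x ,_)) ys) ℕ.+ c ℕ.* length (filter P? xs)
        ≡⟨ add-fibre ⟩
      c ℕ.* length (filter P? (x ∷ xs)) ∎
      where
      add-fibre : length (filter (R? ∘ (x ,_)) ys) ℕ.+ c ℕ.* length (filter P? xs)
                ≡ c ℕ.* length (filter P? (x ∷ xs))
      add-fibre with P? x
      ... | yes Px = trans (cong (ℕ._+ _) (fibre-P x Px)) (sym (ℕ.*-suc c _))
      ... | no ¬Px = cong (ℕ._+ _) (fibre-¬P x ¬Px)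

  length-filter-split : {P Q : A → Set} (P? : ∀ x → Dec (P x)) (Q? : ∀ x → Dec (Q x)) → ∀ xs →
    length (filter P? xs)
      ≡ length (filter (λ x → P? x ×-dec Q? x) xs) ℕ.+ length (filter (λ x → P? x ×-dec ¬? (Q? x)) xs)
  length-filter-split P? Q? []       = refl
  length-filter-split P? Q? (x ∷ xs) with P? x | Q? x
  ... | yes _ | yes _ = cong suc (length-filter-split P? Q? xs)
  ... | yes _ | no  _ = trans (cong suc (length-filter-split P? Q? xs)) (sym (ℕ.+-suc _ _))
  ... | no  _ | _     = length-filter-split P? Q? xs

  module _ (_≟_ : DecidableEquality A) where

    length-Unique≡suc-length-filter-≢ : {xs : List A} {x : A} → Unique xs → x ∈ xs →
      length xs ≡ suc (length (filter (λ y → ¬? (y ≟ x)) xs))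
    length-Unique≡suc-length-filter-≢ {y ∷ ys} (y∉ys ∷ _) (here refl) = cong suc (sym (begin
      length (filter ≢y? (y ∷ ys)) ≡⟨ cong length (List.filter-reject ≢y? (λ y≢y → y≢y refl)) ⟩
      length (filter ≢y? ys)       ≡⟨ cong length (List.filter-all ≢y? (All.map ≢-sym y∉ys)) ⟩
      length ys                    ∎))
      where
      ≢y? : ∀ z → Dec (z ≢ y)
      ≢y? z = ¬? (z ≟ y)
    length-Unique≡suc-length-filter-≢ {y ∷ ys} {x} (y∉ys ∷ !ys) (there x∈ys) = begin
      suc (length ys)
        ≡⟨ cong suc (length-Unique≡suc-length-filter-≢ !ys x∈ys) ⟩
      suc (length (y ∷ filter ≢x? ys))
        ≡⟨ cong (suc ∘ length) (List.filter-accept ≢x? (All.lookup y∉ys x∈ys)) ⟨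
      suc (length (filter ≢x? (y ∷ ys))) ∎
      where
      ≢x? : ∀ z → Dec (z ≢ x)
      ≢x? z = ¬? (z ≟ x)

module Field (F : FiniteField) where
  open FiniteField F using (Carrier; isCommutativeRing; 0≢1; inverse; _≟_)
  open ≡-Reasoning

  ring : CommutativeRing 0ℓ 0ℓ
  ring = record { isCommutativeRing = isCommutativeRing }

  open CommutativeRing ring public
    using (_+_; _*_; -_; 0#; 1#; +-identityˡ; +-identityʳ; *-identityˡ; *-identityʳ; zeroˡ; zeroʳ;
           -‿inverseˡ; -‿inverseʳ; *-assoc; *-comm)
  open RingProperties (CommutativeRing.ring ring) public using (x+x≈x⇒x≈0)
  open import Algebra.Solver.Ring.NaturalCoefficients.Default (CommutativeRing.commutativeSemiring ring) public
    using (solve; _:=_; _:+_; _:*_; con)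

  -- Totalised by 0 ⁻¹ = 0, so that it can be applied before nonzeroness is known.
  _⁻¹ : Carrier → Carrier
  x ⁻¹ with x ≟ 0#
  ... | yes _  = 0#
  ... | no x≢0 = proj₁ (inverse x x≢0)

  ⁻¹-inverseʳ : ∀ {x} → x ≢ 0# → x * x ⁻¹ ≡ 1#
  ⁻¹-inverseʳ {x} x≢0 with x ≟ 0#
  ... | yes x≡0 = contradiction x≡0 x≢0
  ... | no x≢0′ = proj₂ (inverse x x≢0′)

  ⁻¹-inverseˡ : ∀ {x} → x ≢ 0# → x ⁻¹ * x ≡ 1#
  ⁻¹-inverseˡ x≢0 = trans (*-comm _ _) (⁻¹-inverseʳ x≢0)

  1≢0 : 1# ≢ 0#
  1≢0 = ≢-sym 0≢1

  *-cancelˡ : ∀ {a b c} → a ≢ 0# → a * b ≡ a * c → b ≡ c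
  *-cancelˡ {a} {b} {c} a≢0 ab≡ac = begin
    b                ≡⟨ *-identityˡ b ⟨
    1# * b           ≡⟨ cong (_* b) (⁻¹-inverseˡ a≢0) ⟨
    (a ⁻¹ * a) * b   ≡⟨ *-assoc _ _ _ ⟩
    a ⁻¹ * (a * b)   ≡⟨ cong (a ⁻¹ *_) ab≡ac ⟩
    a ⁻¹ * (a * c)   ≡⟨ *-assoc _ _ _ ⟨
    (a ⁻¹ * a) * c   ≡⟨ cong (_* c) (⁻¹-inverseˡ a≢0) ⟩
    1# * c           ≡⟨ *-identityˡ c ⟩
    c                ∎

  *≡0⇒≡0 : ∀ {a b} → a ≢ 0# → a * b ≡ 0# → b ≡ 0#
  *≡0⇒≡0 {a} a≢0 ab≡0 = *-cancelˡ a≢0 (trans ab≡0 (sym (zeroʳ a)))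

  *≡1⇒≢0 : ∀ {a b} → a * b ≡ 1# → b ≢ 0#
  *≡1⇒≢0 {a} ab≡1 refl = 0≢1 (trans (sym (zeroʳ a)) ab≡1)

  ⁻¹-unique : ∀ {a b} → a * b ≡ 1# → b ⁻¹ ≡ a
  ⁻¹-unique {a} {b} ab≡1 =
    *-cancelˡ b≢0 (trans (⁻¹-inverseʳ b≢0) (sym (trans (*-comm b a) ab≡1)))
    where
    b≢0 : b ≢ 0#
    b≢0 = *≡1⇒≢0 ab≡1

  ⁻¹-≢0 : ∀ {a} → a ≢ 0# → a ⁻¹ ≢ 0#
  ⁻¹-≢0 a≢0 = *≡1⇒≢0 (⁻¹-inverseʳ a≢0)

  nonzero? : (c : Carrier) → Dec (c ≢ 0#)
  nonzero? c = ¬? (c ≟ 0#)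

module Vectors (F : FiniteField) where
  open Field F
  open FiniteField F using (Carrier; 0≢1; _≟_)
  open ≡-Reasoning

  V : ℕ → Set
  V = Vect F

  infix 8 _∙_
  _∙_ : ∀ {k} → V k → V k → Carrier
  _∙_ = _·_ F

  0ᵛ : ∀ {k} → V k
  0ᵛ = zeroV F

  infixr 9 _*ᵛ_
  _*ᵛ_ : ∀ {k} → Carrier → V k → V k
  c *ᵛ v = Vec.map (c *_) v

  ∙-zeroʳ : ∀ {k} (ξ : V k) → ξ ∙ 0ᵛ ≡ 0#
  ∙-zeroʳ []      = refl
  ∙-zeroʳ (a ∷ ξ) = trans (cong₂ _+_ (zeroʳ a) (∙-zeroʳ ξ)) (+-identityʳ 0#)

  ∙≡1⇒≢0ᵛ : ∀ {k} {a z : V k} → a ∙ z ≡ 1# → z ≢ 0ᵛ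
  ∙≡1⇒≢0ᵛ {a = a} a∙z≡1 refl = 0≢1 (trans (sym (∙-zeroʳ a)) a∙z≡1)

  ∙-*ᵛʳ : ∀ {k} c (ξ x : V k) → ξ ∙ (c *ᵛ x) ≡ c * (ξ ∙ x)
  ∙-*ᵛʳ c []      []      = sym (zeroʳ c)
  ∙-*ᵛʳ c (a ∷ ξ) (b ∷ x) = trans (cong (a * (c * b) +_) (∙-*ᵛʳ c ξ x))
    (solve 4 (λ a b c d → a :* (c :* b) :+ c :* d := c :* (a :* b :+ d)) refl a b c (ξ ∙ x))

  ∙-*ᵛˡ : ∀ {k} c (ξ x : V k) → (c *ᵛ ξ) ∙ x ≡ c * (ξ ∙ x)
  ∙-*ᵛˡ c []      []      = sym (zeroʳ c)
  ∙-*ᵛˡ c (a ∷ ξ) (b ∷ x) = trans (cong ((c * a) * b +_) (∙-*ᵛˡ c ξ x))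
    (solve 4 (λ a b c d → (c :* a) :* b :+ c :* d := c :* (a :* b :+ d)) refl a b c (ξ ∙ x))

  *ᵛ-assoc : ∀ {k} a b (v : V k) → a *ᵛ b *ᵛ v ≡ (a * b) *ᵛ v
  *ᵛ-assoc a b []      = refl
  *ᵛ-assoc a b (x ∷ v) = cong₂ _∷_ (sym (*-assoc a b x)) (*ᵛ-assoc a b v)

  *ᵛ-identityˡ : ∀ {k} (v : V k) → 1# *ᵛ v ≡ v
  *ᵛ-identityˡ []      = refl
  *ᵛ-identityˡ (x ∷ v) = cong₂ _∷_ (*-identityˡ x) (*ᵛ-identityˡ v)

  *ᵛ-zeroˡ : ∀ {k} (v : V k) → 0# *ᵛ v ≡ 0ᵛ
  *ᵛ-zeroˡ []      = refl
  *ᵛ-zeroˡ (x ∷ v) = cong₂ _∷_ (zeroˡ x) (*ᵛ-zeroˡ v)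

  *ᵛ-cancelˡ : ∀ {k} {a} (v w : V k) → a ≢ 0# → a *ᵛ v ≡ a *ᵛ w → v ≡ w
  *ᵛ-cancelˡ []      []      a≢0 _  = refl
  *ᵛ-cancelˡ (x ∷ v) (y ∷ w) a≢0 eq =
    cong₂ _∷_ (*-cancelˡ a≢0 (Vec.∷-injectiveˡ eq)) (*ᵛ-cancelˡ v w a≢0 (Vec.∷-injectiveʳ eq))

  shift : ∀ {k} → Carrier → V k → V k → V k
  shift s = Vec.zipWith (λ u y → y + s * u)

  ∙-shift : ∀ {k} (a : V k) s u y → a ∙ shift s u y ≡ a ∙ y + s * (a ∙ u)
  ∙-shift []       s []       []       = sym (trans (cong (0# +_) (zeroʳ s)) (+-identityʳ 0#))
  ∙-shift (a ∷ as) s (u ∷ us) (y ∷ ys) = trans (cong (a * (y + s * u) +_) (∙-shift as s us ys))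
    (solve 6 (λ a y s u A B → a :* (y :+ s :* u) :+ (A :+ s :* B) := (a :* y :+ A) :+ s :* (a :* u :+ B))
           refl a y s u (as ∙ ys) (as ∙ us))

  shift-cancel : ∀ {k s s′} → s + s′ ≡ 0# → (u y : V k) → shift s′ u (shift s u y) ≡ y
  shift-cancel                 _       []       []       = refl
  shift-cancel {s = s} {s′} s+s′≡0 (u ∷ us) (y ∷ ys) = cong₂ _∷_ cancel (shift-cancel s+s′≡0 us ys)
    where
    cancel : y + s * u + s′ * u ≡ y
    cancel = begin
      y + s * u + s′ * u
        ≡⟨ solve 4 (λ y s u s′ → y :+ s :* u :+ s′ :* u := y :+ (s :+ s′) :* u) refl y s u s′ ⟩
      y + (s + s′) * u
        ≡⟨ cong (λ c → y + c * u) s+s′≡0 ⟩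
      y + 0# * u
        ≡⟨ trans (cong (y +_) (zeroˡ u)) (+-identityʳ y) ⟩
      y ∎

  ¬Normalized-0ᵛ : ∀ {k} → ¬ Normalized F (0ᵛ {k})
  ¬Normalized-0ᵛ {suc k} (inj₁ (_ , n)) = ¬Normalized-0ᵛ n
  ¬Normalized-0ᵛ {suc k} (inj₂ 0≡1)     = 0≢1 0≡1

  Normalized⇒≢0ᵛ : ∀ {k} {v : V k} → Normalized F v → v ≢ 0ᵛ
  Normalized⇒≢0ᵛ n refl = ¬Normalized-0ᵛ n

  *ᵛ-cancelʳ-Normalized : ∀ {k} {a b} (v : V k) → Normalized F v → a *ᵛ v ≡ b *ᵛ v → a ≡ b
  *ᵛ-cancelʳ-Normalized (_ ∷ v) (inj₁ (refl , n)) eq = *ᵛ-cancelʳ-Normalized v n (Vec.∷-injectiveʳ eq)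
  *ᵛ-cancelʳ-Normalized {a = a} {b} (_ ∷ v) (inj₂ refl) eq =
    trans (sym (*-identityʳ a)) (trans (Vec.∷-injectiveˡ eq) (*-identityʳ b))

  *ᵛ-Normalized≡0ᵛ⇒≡0 : ∀ {k} {a} (v : V k) → Normalized F v → a *ᵛ v ≡ 0ᵛ → a ≡ 0#
  *ᵛ-Normalized≡0ᵛ⇒≡0 v n eq = *ᵛ-cancelʳ-Normalized v n (trans eq (sym (*ᵛ-zeroˡ v)))

  *ᵛ-injective-Normalized : ∀ {k} {a b} (v w : V k) → Normalized F v → Normalized F w →
    a ≢ 0# → b ≢ 0# → a *ᵛ v ≡ b *ᵛ w → a ≡ b × v ≡ w
  *ᵛ-injective-Normalized (_ ∷ v) (_ ∷ w) (inj₁ (refl , nv)) (inj₁ (refl , nw)) a≢0 b≢0 eq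
    with refl , refl ← *ᵛ-injective-Normalized v w nv nw a≢0 b≢0 (Vec.∷-injectiveʳ eq) = refl , refl
  *ᵛ-injective-Normalized {b = b} (_ ∷ v) (_ ∷ w) (inj₁ (refl , _)) (inj₂ refl) _ b≢0 eq =
    contradiction (trans (sym (*-identityʳ b)) (trans (sym (Vec.∷-injectiveˡ eq)) (zeroʳ _))) b≢0
  *ᵛ-injective-Normalized {a = a} (_ ∷ v) (_ ∷ w) (inj₂ refl) (inj₁ (refl , _)) a≢0 _ eq =
    contradiction (trans (sym (*-identityʳ a)) (trans (Vec.∷-injectiveˡ eq) (zeroʳ _))) a≢0
  *ᵛ-injective-Normalized {a = a} {b} (_ ∷ v) (_ ∷ w) (inj₂ refl) (inj₂ refl) a≢0 _ eq
    with refl ← trans (sym (*-identityʳ a)) (trans (Vec.∷-injectiveˡ eq) (*-identityʳ b)) =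
    refl , cong (1# ∷_) (*ᵛ-cancelˡ v w a≢0 (Vec.∷-injectiveʳ eq))

  Normalized-*ᵛ⇒≡1 : ∀ {k} {a} (v : V k) → Normalized F v → Normalized F (a *ᵛ v) → a ≡ 1#
  Normalized-*ᵛ⇒≡1 {a = a} v nv nav =
    proj₁ (*ᵛ-injective-Normalized v (a *ᵛ v) nv nav a≢0 1≢0 (sym (*ᵛ-identityˡ (a *ᵛ v))))
    where
    a≢0 : a ≢ 0#
    a≢0 refl = ¬Normalized-0ᵛ (subst (Normalized F) (*ᵛ-zeroˡ v) nav)

  normalize : ∀ {k} (v : V k) → v ≢ 0ᵛ →
    Σ[ a ∈ Carrier ] Σ[ w ∈ V k ] a ≢ 0# × Normalized F w × v ≡ a *ᵛ w
  normalize []      v≢0 = contradiction refl v≢0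
  normalize (x ∷ v) v≢0 with x ≟ 0#
  ... | yes refl with a , w , a≢0 , nw , refl ← normalize v (v≢0 ∘ cong (0# ∷_)) =
    a , 0# ∷ w , a≢0 , inj₁ (refl , nw) , cong (_∷ _) (sym (zeroʳ a))
  ... | no x≢0 =
    x , 1# ∷ x ⁻¹ *ᵛ v , x≢0 , inj₂ refl , cong₂ _∷_ (sym (*-identityʳ x)) (sym x*ᵛx⁻¹*ᵛv≡v)
    where
    x*ᵛx⁻¹*ᵛv≡v : x *ᵛ x ⁻¹ *ᵛ v ≡ v
    x*ᵛx⁻¹*ᵛv≡v = trans (*ᵛ-assoc _ _ v) (trans (cong (_*ᵛ v) (⁻¹-inverseʳ x≢0)) (*ᵛ-identityˡ v))

  Normalized⇒∃∙≡1 : ∀ {k} (a : V k) → Normalized F a → Σ[ z ∈ V k ] a ∙ z ≡ 1#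
  Normalized⇒∃∙≡1 (_ ∷ a) (inj₁ (refl , n)) with z , a∙z≡1 ← Normalized⇒∃∙≡1 a n =
    0# ∷ z , trans (cong₂ _+_ (zeroˡ 0#) a∙z≡1) (+-identityˡ 1#)
  Normalized⇒∃∙≡1 (_ ∷ a) (inj₂ refl) =
    1# ∷ 0ᵛ , trans (cong₂ _+_ (*-identityˡ 1#) (∙-zeroʳ a)) (+-identityʳ 1#)

module Enumeration (F : FiniteField) where
  open Counting
  open Field F
  open Vectors F
  open FiniteField F using (Carrier; _≟_; size; enum)
  open ≡-Reasoning

  elems-unique : Unique (elems F)
  elems-unique = Unique.map⁺ (Injection.injective (↔⇒↣ enum)) (Unique.allFin⁺ size)

  length-elems : length (elems F) ≡ size
  length-elems = trans (List.length-map (Inverse.to enum) (allFin size)) (List.length-tabulate (λ i → i))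

  allVecs-unique : ∀ k → Unique (allVecs F k)
  allVecs-unique zero    = [] ∷ []
  allVecs-unique (suc k) = Unique.cartesianProductWith⁺ _∷_ Vec.∷-injective elems-unique (allVecs-unique k)

  length-allVecs : ∀ k → length (allVecs F k) ≡ size ^ k
  length-allVecs zero    = refl
  length-allVecs (suc k) = trans (length-cartesianProductWith _∷_ (elems F) (allVecs F k))
    (cong₂ ℕ._*_ length-elems (length-allVecs k))

  allMats-unique : ∀ k → Unique (allMats F k)
  allMats-unique k = allRows-unique k
    where
    allRows-unique : ∀ m → Unique (allRows F k m)
    allRows-unique zero    = [] ∷ []
    allRows-unique (suc m) =
      Unique.cartesianProductWith⁺ _∷_ Vec.∷-injective (allVecs-unique k) (allRows-unique m)

  nonzeroᵛ? : ∀ {k} (v : V k) → Dec (v ≢ 0ᵛ)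
  nonzeroᵛ? v = ¬? (≡-dec _≟_ v 0ᵛ)

  nonzeros : List Carrier
  nonzeros = filter nonzero? (elems F)

  nonzeroVecs : ∀ k → List (V k)
  nonzeroVecs k = filter nonzeroᵛ? (allVecs F k)

  points : ∀ k → List (V k)
  points k = filter (normalized? F) (allVecs F k)

  size≡suc-length-nonzeros : size ≡ suc (length nonzeros)
  size≡suc-length-nonzeros =
    trans (sym length-elems) (length-Unique≡suc-length-filter-≢ _≟_ elems-unique (elems-complete F 0#))

  size^k≡suc-length-nonzeroVecs : ∀ k → size ^ k ≡ suc (length (nonzeroVecs k))
  size^k≡suc-length-nonzeroVecs k = trans (sym (length-allVecs k))
    (length-Unique≡suc-length-filter-≢ (≡-dec _≟_) (allVecs-unique k) (allVecs-complete F 0ᵛ))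

  -- Every nonzero vector is uniquely a nonzero multiple of a normalized one.
  length-nonzeros*length-points : ∀ k → length nonzeros ℕ.* length (points k) ≡ length (nonzeroVecs k)
  length-nonzeros*length-points k =
    trans (sym (length-cartesianProductWith _,_ nonzeros (points k)))
      (bijection⇒length≡ (Unique.cartesianProduct⁺ (Unique.filter⁺ nonzero? elems-unique)
                                                   (Unique.filter⁺ (normalized? F) (allVecs-unique k)))
                         (Unique.filter⁺ nonzeroᵛ? (allVecs-unique k))
                         (λ (a , w) → a *ᵛ w) into inj onto)
    where
    scaledPoints : List (Carrier × V k)
    scaledPoints = cartesianProduct nonzeros (points k)
    scaledPoint : ∀ {a w} → (a , w) ∈ scaledPoints → a ≢ 0# × Normalized F w
    scaledPoint p with a∈ , w∈ ← ∈-cartesianProduct⁻ nonzeros (points k) p =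
      proj₂ (∈-filter⁻ nonzero? {xs = elems F} a∈) , proj₂ (∈-filter⁻ (normalized? F) {xs = allVecs F k} w∈)
    into : ∀ {p} → p ∈ scaledPoints → proj₁ p *ᵛ proj₂ p ∈ nonzeroVecs k
    into {a , w} p with a≢0 , nw ← scaledPoint p =
      ∈-filter⁺ nonzeroᵛ? (allVecs-complete F _) (a≢0 ∘ *ᵛ-Normalized≡0ᵛ⇒≡0 w nw)
    inj : ∀ {p p′} → p ∈ scaledPoints → p′ ∈ scaledPoints →
          proj₁ p *ᵛ proj₂ p ≡ proj₁ p′ *ᵛ proj₂ p′ → p ≡ p′
    inj {a , w} {b , w′} p p′ eq with a≢0 , nw ← scaledPoint p | b≢0 , nw′ ← scaledPoint p′
      with refl , refl ← *ᵛ-injective-Normalized w w′ nw nw′ a≢0 b≢0 eq = refl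
    onto : ∀ {v} → v ∈ nonzeroVecs k → ∃[ p ] p ∈ scaledPoints × proj₁ p *ᵛ proj₂ p ≡ v
    onto {v} v∈ with a , w , a≢0 , nw , refl ← normalize v (proj₂ (∈-filter⁻ nonzeroᵛ? {xs = allVecs F k} v∈)) =
      (a , w) , ∈-cartesianProduct⁺ (∈-filter⁺ nonzero? (elems-complete F a) a≢0)
                                    (∈-filter⁺ (normalized? F) (allVecs-complete F w) nw) , refl

  length-points : ∀ k → length (points k) ≡ _/_ (size ^ k ∸ 1) (size ∸ 1) {{q∸1-nonZero F}}
  length-points k = sym (begin
    _/_ (size ^ k ∸ 1) (size ∸ 1) {{q∸1-nonZero F}}
      ≡⟨ /-congˡ {{q∸1-nonZero F}} (cong (_∸ 1) (size^k≡suc-length-nonzeroVecs k)) ⟩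
    _/_ (length (nonzeroVecs k)) (size ∸ 1) {{q∸1-nonZero F}}
      ≡⟨ /-congʳ {{q∸1-nonZero F}} size∸1≡length-nonzeros ⟩
    length (nonzeroVecs k) / length nonzeros
      ≡⟨ /-congˡ (trans (sym (length-nonzeros*length-points k)) (ℕ.*-comm (length nonzeros) _)) ⟩
    length (points k) ℕ.* length nonzeros / length nonzeros
      ≡⟨ m*n/n≡m (length (points k)) (length nonzeros) ⟩
    length (points k) ∎)
    where
    size∸1≡length-nonzeros : size ∸ 1 ≡ length nonzeros
    size∸1≡length-nonzeros = cong (_∸ 1) size≡suc-length-nonzeros
    instance
      length-nonzeros≢0 : NonZero (length nonzeros)
      length-nonzeros≢0 = subst NonZero size∸1≡length-nonzeros (q∸1-nonZero F)

module AffinePoints (F : FiniteField) where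
  open Counting
  open Field F
  open Vectors F
  open Enumeration F
  open FiniteField F using (Carrier; 0≢1; _≟_; size)
  open ≡-Reasoning

  record Dual {k} (a b : V k) : Set where
    field
      y₁ y₂  : V k
      a∙y₁≡1 : a ∙ y₁ ≡ 1#
      b∙y₁≡0 : b ∙ y₁ ≡ 0#
      a∙y₂≡0 : a ∙ y₂ ≡ 0#
      b∙y₂≡1 : b ∙ y₂ ≡ 1#

  Normalized⇒Dual : ∀ {k} {a b y₀ : V k} → Normalized F a → a ∙ y₀ ≡ 0# → b ∙ y₀ ≢ 0# → Dual a b
  Normalized⇒Dual {a = a} {b} {y₀} na a∙y₀≡0 b∙y₀≢0 =
    record { y₁ = y₁ ; y₂ = y₂
           ; a∙y₁≡1 = a∙y₁≡1 ; b∙y₁≡0 = b∙y₁≡0 ; a∙y₂≡0 = a∙y₂≡0 ; b∙y₂≡1 = b∙y₂≡1 }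
    where
    z : V _
    z = proj₁ (Normalized⇒∃∙≡1 a na)
    y₂ y₁ : V _
    y₂ = (b ∙ y₀) ⁻¹ *ᵛ y₀
    y₁ = shift (- (b ∙ z)) y₂ z
    a∙y₂≡0 : a ∙ y₂ ≡ 0#
    a∙y₂≡0 = trans (∙-*ᵛʳ _ a y₀) (trans (cong (_ *_) a∙y₀≡0) (zeroʳ _))
    b∙y₂≡1 : b ∙ y₂ ≡ 1#
    b∙y₂≡1 = trans (∙-*ᵛʳ _ b y₀) (⁻¹-inverseˡ b∙y₀≢0)
    a∙y₁≡1 : a ∙ y₁ ≡ 1#
    a∙y₁≡1 = begin
      a ∙ y₁
        ≡⟨ ∙-shift a _ y₂ z ⟩
      a ∙ z + (- (b ∙ z)) * (a ∙ y₂)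
        ≡⟨ cong₂ (λ p q → p + (- (b ∙ z)) * q) (proj₂ (Normalized⇒∃∙≡1 a na)) a∙y₂≡0 ⟩
      1# + (- (b ∙ z)) * 0#
        ≡⟨ solve 1 (λ x → con 1 :+ x :* con 0 := con 1) refl (- (b ∙ z)) ⟩
      1# ∎
    b∙y₁≡0 : b ∙ y₁ ≡ 0#
    b∙y₁≡0 = begin
      b ∙ y₁                         ≡⟨ ∙-shift b _ y₂ z ⟩
      b ∙ z + (- (b ∙ z)) * (b ∙ y₂) ≡⟨ cong (λ q → b ∙ z + (- (b ∙ z)) * q) b∙y₂≡1 ⟩
      b ∙ z + (- (b ∙ z)) * 1#       ≡⟨ cong (b ∙ z +_) (*-identityʳ _) ⟩
      b ∙ z + (- (b ∙ z))            ≡⟨ -‿inverseʳ (b ∙ z) ⟩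
      0#                             ∎

  module _ {k} (a b : V k) where

    kernel : List (V k)
    kernel = filter (λ z → ((a ∙ z) ≟ 0#) ×-dec ((b ∙ z) ≟ 0#)) (allVecs F k)

    fibre : List (V k)
    fibre = filter (λ z → ((a ∙ z) ≟ 0#) ×-dec ((b ∙ z) ≟ 1#)) (allVecs F k)

    affinePoint? : (y : V k) → Dec (Normalized F y × a ∙ y ≡ 0# × b ∙ y ≢ 0#)
    affinePoint? y = normalized? F y ×-dec ((a ∙ y) ≟ 0#) ×-dec nonzero? (b ∙ y)

    affinePoints : List (V k)
    affinePoints = filter affinePoint? (allVecs F k)

    length-affinePoints≡length-fibre : length affinePoints ≡ length fibre
    length-affinePoints≡length-fibre =
      bijection⇒length≡ (Unique.filter⁺ _ (allVecs-unique k)) (Unique.filter⁺ _ (allVecs-unique k))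
                        (λ y → (b ∙ y) ⁻¹ *ᵛ y) into inj onto
      where
      affine : ∀ {y} → y ∈ affinePoints → Normalized F y × a ∙ y ≡ 0# × b ∙ y ≢ 0#
      affine y∈ = proj₂ (∈-filter⁻ affinePoint? {xs = allVecs F k} y∈)
      into : ∀ {y} → y ∈ affinePoints → (b ∙ y) ⁻¹ *ᵛ y ∈ fibre
      into {y} y∈ with _ , a∙y≡0 , b∙y≢0 ← affine y∈ =
        ∈-filter⁺ _ (allVecs-complete F _)
          ( trans (∙-*ᵛʳ _ a y) (trans (cong (_ *_) a∙y≡0) (zeroʳ _))
          , trans (∙-*ᵛʳ _ b y) (⁻¹-inverseˡ b∙y≢0))
      inj : ∀ {y y′} → y ∈ affinePoints → y′ ∈ affinePoints →
            (b ∙ y) ⁻¹ *ᵛ y ≡ (b ∙ y′) ⁻¹ *ᵛ y′ → y ≡ y′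
      inj {y} {y′} y∈ y′∈ eq with ny , _ , b∙y≢0 ← affine y∈ | ny′ , _ , b∙y′≢0 ← affine y′∈ =
        proj₂ (*ᵛ-injective-Normalized y y′ ny ny′ (⁻¹-≢0 b∙y≢0) (⁻¹-≢0 b∙y′≢0) eq)
      onto : ∀ {z} → z ∈ fibre → ∃[ y ] y ∈ affinePoints × (b ∙ y) ⁻¹ *ᵛ y ≡ z
      onto {z} z∈
        with a∙z≡0 , b∙z≡1 ← proj₂ (∈-filter⁻ _ {xs = allVecs F k} z∈)
        with c , y , c≢0 , ny , refl ← normalize z (∙≡1⇒≢0ᵛ {a = b} b∙z≡1) =
        y , ∈-filter⁺ affinePoint? (allVecs-complete F y) (ny , a∙y≡0 , *≡1⇒≢0 c*b∙y≡1) ,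
        cong (_*ᵛ y) (⁻¹-unique c*b∙y≡1)
        where
        a∙y≡0 : a ∙ y ≡ 0#
        a∙y≡0 = *≡0⇒≡0 c≢0 (trans (sym (∙-*ᵛʳ c a y)) a∙z≡0)
        c*b∙y≡1 : c * (b ∙ y) ≡ 1#
        c*b∙y≡1 = trans (sym (∙-*ᵛʳ c b y)) b∙z≡1

    module _ (dual : Dual a b) where
      open Dual dual

      length-fibre≡length-kernel : length fibre ≡ length kernel
      length-fibre≡length-kernel =
        sym (bijection⇒length≡ (Unique.filter⁺ _ (allVecs-unique k)) (Unique.filter⁺ _ (allVecs-unique k))
                               (shift 1# y₂) into inj onto)
        where
        ∙-translate : ∀ c {z s c₀ c₂} → c ∙ z ≡ c₀ → c ∙ y₂ ≡ c₂ →
                      c ∙ shift s y₂ z ≡ c₀ + s * c₂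
        ∙-translate c {z} {s} refl refl = ∙-shift c s y₂ z
        into : ∀ {z} → z ∈ kernel → shift 1# y₂ z ∈ fibre
        into {z} z∈ with a∙z≡0 , b∙z≡0 ← proj₂ (∈-filter⁻ _ {xs = allVecs F k} z∈) =
          ∈-filter⁺ _ (allVecs-complete F _)
            ( trans (∙-translate a a∙z≡0 a∙y₂≡0) (solve 0 (con 0 :+ con 1 :* con 0 := con 0) refl)
            , trans (∙-translate b b∙z≡0 b∙y₂≡1) (solve 0 (con 0 :+ con 1 :* con 1 := con 1) refl))
        inj : ∀ {z z′} → z ∈ kernel → z′ ∈ kernel → shift 1# y₂ z ≡ shift 1# y₂ z′ → z ≡ z′
        inj {z} {z′} _ _ eq = trans (sym (shift-cancel (-‿inverseʳ 1#) y₂ z))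
          (trans (cong (shift (- 1#) y₂) eq) (shift-cancel (-‿inverseʳ 1#) y₂ z′))
        onto : ∀ {v} → v ∈ fibre → ∃[ z ] z ∈ kernel × shift 1# y₂ z ≡ v
        onto {v} v∈ with a∙v≡0 , b∙v≡1 ← proj₂ (∈-filter⁻ _ {xs = allVecs F k} v∈) =
          shift (- 1#) y₂ v ,
          ∈-filter⁺ _ (allVecs-complete F _)
            ( trans (∙-translate a a∙v≡0 a∙y₂≡0) (solve 1 (λ m → con 0 :+ m :* con 0 := con 0) refl (- 1#))
            , trans (∙-translate b b∙v≡1 b∙y₂≡1) (trans (cong (1# +_) (*-identityʳ (- 1#))) (-‿inverseʳ 1#))) ,
          shift-cancel (-‿inverseˡ 1#) y₂ v

      fromKernel : V k × Carrier × Carrier → V k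
      fromKernel (z , s , t) = shift s y₁ (shift t y₂ z)

      toKernel : Carrier → Carrier → V k → V k
      toKernel s t v = shift (- t) y₂ (shift (- s) y₁ v)

      toKernel-fromKernel : ∀ z s t → toKernel s t (fromKernel (z , s , t)) ≡ z
      toKernel-fromKernel z s t =
        trans (cong (shift (- t) y₂) (shift-cancel (-‿inverseʳ s) y₁ _)) (shift-cancel (-‿inverseʳ t) y₂ z)

      fromKernel-toKernel : ∀ v s t → fromKernel (toKernel s t v , s , t) ≡ v
      fromKernel-toKernel v s t =
        trans (cong (shift s y₁) (shift-cancel (-‿inverseˡ t) y₂ _)) (shift-cancel (-‿inverseˡ s) y₁ v)

      ∙-fromKernel : ∀ c {z s t c₀ c₁ c₂} → c ∙ z ≡ c₀ → c ∙ y₁ ≡ c₁ → c ∙ y₂ ≡ c₂ →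
                     c ∙ fromKernel (z , s , t) ≡ c₀ + t * c₂ + s * c₁
      ∙-fromKernel c {z} {s} {t} refl refl refl =
        trans (∙-shift c s y₁ _) (cong (_+ s * (c ∙ y₁)) (∙-shift c t y₂ z))

      ∙-toKernel : ∀ c {v s t c₀ c₁ c₂} → c ∙ v ≡ c₀ → c ∙ y₁ ≡ c₁ → c ∙ y₂ ≡ c₂ →
                   c ∙ toKernel s t v ≡ c₀ + (- s) * c₁ + (- t) * c₂
      ∙-toKernel c {v} {s} {t} refl refl refl =
        trans (∙-shift c (- t) y₂ _) (cong (_+ (- t) * (c ∙ y₂)) (∙-shift c (- s) y₁ v))

      a∙fromKernel : ∀ {z} s t → a ∙ z ≡ 0# → a ∙ fromKernel (z , s , t) ≡ s
      a∙fromKernel s t a∙z≡0 = trans (∙-fromKernel a a∙z≡0 a∙y₁≡1 a∙y₂≡0)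
        (solve 2 (λ s t → con 0 :+ t :* con 0 :+ s :* con 1 := s) refl s t)

      b∙fromKernel : ∀ {z} s t → b ∙ z ≡ 0# → b ∙ fromKernel (z , s , t) ≡ t
      b∙fromKernel s t b∙z≡0 = trans (∙-fromKernel b b∙z≡0 b∙y₁≡0 b∙y₂≡1)
        (solve 2 (λ s t → con 0 :+ t :* con 1 :+ s :* con 0 := t) refl s t)

      a∙toKernel≡0 : ∀ v → a ∙ toKernel (a ∙ v) (b ∙ v) v ≡ 0#
      a∙toKernel≡0 v = trans (∙-toKernel a refl a∙y₁≡1 a∙y₂≡0) (trans
        (solve 3 (λ x S T → x :+ S :* con 1 :+ T :* con 0 := x :+ S) refl (a ∙ v) (- (a ∙ v)) (- (b ∙ v)))
        (-‿inverseʳ (a ∙ v)))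

      b∙toKernel≡0 : ∀ v → b ∙ toKernel (a ∙ v) (b ∙ v) v ≡ 0#
      b∙toKernel≡0 v = trans (∙-toKernel b refl b∙y₁≡0 b∙y₂≡1) (trans
        (solve 3 (λ x S T → x :+ S :* con 0 :+ T :* con 1 := x :+ T) refl (b ∙ v) (- (a ∙ v)) (- (b ∙ v)))
        (-‿inverseʳ (b ∙ v)))

      length-kernel : length kernel ℕ.* (size ℕ.* size) ≡ size ^ k
      length-kernel = begin
        length kernel ℕ.* (size ℕ.* size)
          ≡⟨ cong (λ n → length kernel ℕ.* (n ℕ.* n)) length-elems ⟨
        length kernel ℕ.* (length (elems F) ℕ.* length (elems F))
          ≡⟨ cong (length kernel ℕ.*_) (length-cartesianProductWith _,_ (elems F) (elems F)) ⟨
        length kernel ℕ.* length scalars²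
          ≡⟨ length-cartesianProductWith _,_ kernel scalars² ⟨
        length (cartesianProduct kernel scalars²)
          ≡⟨ bijection⇒length≡ (Unique.cartesianProduct⁺ (Unique.filter⁺ _ (allVecs-unique k))
                                  (Unique.cartesianProduct⁺ elems-unique elems-unique))
                               (allVecs-unique k) fromKernel (λ _ → allVecs-complete F _) inj onto ⟩
        length (allVecs F k)
          ≡⟨ length-allVecs k ⟩
        size ^ k ∎
        where
        scalars² : List (Carrier × Carrier)
        scalars² = cartesianProduct (elems F) (elems F)
        in-kernel : ∀ {z s t} → (z , s , t) ∈ cartesianProduct kernel scalars² → a ∙ z ≡ 0# × b ∙ z ≡ 0#
        in-kernel p = proj₂ (∈-filter⁻ _ {xs = allVecs F k} (proj₁ (∈-cartesianProduct⁻ kernel scalars² p)))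
        inj : ∀ {p p′} → p ∈ cartesianProduct kernel scalars² → p′ ∈ cartesianProduct kernel scalars² →
              fromKernel p ≡ fromKernel p′ → p ≡ p′
        inj {z , s , t} {z′ , s′ , t′} p p′ eq
          with a∙z≡0 , b∙z≡0 ← in-kernel p | a∙z′≡0 , b∙z′≡0 ← in-kernel p′
          with refl ← trans (sym (a∙fromKernel s t a∙z≡0))
                            (trans (cong (a ∙_) eq) (a∙fromKernel s′ t′ a∙z′≡0))
             | refl ← trans (sym (b∙fromKernel s t b∙z≡0))
                            (trans (cong (b ∙_) eq) (b∙fromKernel s′ t′ b∙z′≡0)) =
          cong (_, s , t)
            (trans (sym (toKernel-fromKernel z s t)) (trans (cong (toKernel s t) eq) (toKernel-fromKernel z′ s t)))
        onto : ∀ {v} → v ∈ allVecs F k → ∃[ p ] p ∈ cartesianProduct kernel scalars² × fromKernel p ≡ v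
        onto {v} _ =
          (toKernel (a ∙ v) (b ∙ v) v , a ∙ v , b ∙ v) ,
          ∈-cartesianProduct⁺ (∈-filter⁺ _ (allVecs-complete F _) (a∙toKernel≡0 v , b∙toKernel≡0 v))
                              (∈-cartesianProduct⁺ (elems-complete F _) (elems-complete F _)) ,
          fromKernel-toKernel v (a ∙ v) (b ∙ v)

  length-affinePoints : ∀ {m} {a b y₀ : V (2 ℕ.+ m)} → Normalized F a → a ∙ y₀ ≡ 0# → b ∙ y₀ ≢ 0# →
    length (affinePoints a b) ≡ size ^ m
  length-affinePoints {m} {a} {b} na a∙y₀≡0 b∙y₀≢0 = ℕ.*-cancelʳ-≡ _ _ (size ℕ.* size) (begin
    length (affinePoints a b) ℕ.* (size ℕ.* size)
      ≡⟨ cong (ℕ._* (size ℕ.* size)) (length-affinePoints≡length-fibre a b) ⟩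
    length (fibre a b) ℕ.* (size ℕ.* size)
      ≡⟨ cong (ℕ._* (size ℕ.* size)) (length-fibre≡length-kernel a b dual) ⟩
    length (kernel a b) ℕ.* (size ℕ.* size)
      ≡⟨ length-kernel a b dual ⟩
    size ^ (2 ℕ.+ m)
      ≡⟨ ℕ.*-assoc size size (size ^ m) ⟨
    size ℕ.* size ℕ.* size ^ m
      ≡⟨ ℕ.*-comm (size ℕ.* size) (size ^ m) ⟩
    size ^ m ℕ.* (size ℕ.* size) ∎)
    where
    dual : Dual a b
    dual = Normalized⇒Dual na a∙y₀≡0 b∙y₀≢0
    instance
      size²≢0 : NonZero (size ℕ.* size)
      size²≢0 = subst (λ q → NonZero (q ℕ.* q)) (sym size≡suc-length-nonzeros) _

module RankOne (F : FiniteField) where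
  open Field F
  open Vectors F
  open FiniteField F using (Carrier)
  open ≡-Reasoning

  -- For square sizes y ⊗ᵛ ξ is definitionally outer F y ξ.
  infix 7 _⊗ᵛ_
  _⊗ᵛ_ : ∀ {i k} → V i → V k → Vec (V k) i
  y ⊗ᵛ ξ = Vec.map (_*ᵛ ξ) y

  Normalized-++ˡ : ∀ {i j} {u : V i} (w : V j) → Normalized F u → Normalized F (u Vec.++ w)
  Normalized-++ˡ {u = _ ∷ u} w (inj₁ (x≡0 , nu)) = inj₁ (x≡0 , Normalized-++ˡ w nu)
  Normalized-++ˡ {u = _ ∷ u} w (inj₂ x≡1)        = inj₂ x≡1

  Normalized-++ʳ : ∀ {i j} {w : V j} (u : V i) → u ≡ 0ᵛ → Normalized F w → Normalized F (u Vec.++ w)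
  Normalized-++ʳ []      _    nw = nw
  Normalized-++ʳ (_ ∷ u) u≡0 nw = inj₁ (Vec.∷-injectiveˡ u≡0 , Normalized-++ʳ u (Vec.∷-injectiveʳ u≡0) nw)

  Normalized-concat-⊗ᵛ : ∀ {i k} {y : V i} {ξ : V k} →
    Normalized F y → Normalized F ξ → Normalized F (concat (y ⊗ᵛ ξ))
  Normalized-concat-⊗ᵛ {y = _ ∷ y} {ξ} (inj₁ (refl , ny)) nξ =
    Normalized-++ʳ (0# *ᵛ ξ) (*ᵛ-zeroˡ ξ) (Normalized-concat-⊗ᵛ ny nξ)
  Normalized-concat-⊗ᵛ {y = _ ∷ y} {ξ} (inj₂ refl) nξ =
    Normalized-++ˡ _ (subst (Normalized F) (sym (*ᵛ-identityˡ ξ)) nξ)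

  ⊗ᵛ-injective-Normalized : ∀ {i k} {y y′ : V i} {ξ ξ′ : V k} →
    Normalized F y → Normalized F y′ → Normalized F ξ → Normalized F ξ′ →
    y ⊗ᵛ ξ ≡ y′ ⊗ᵛ ξ′ → y ≡ y′ × ξ ≡ ξ′
  ⊗ᵛ-injective-Normalized {y = _ ∷ y} {_ ∷ y′} (inj₁ (refl , ny)) (inj₁ (refl , ny′)) nξ nξ′ eq
    with refl , refl ← ⊗ᵛ-injective-Normalized ny ny′ nξ nξ′ (Vec.∷-injectiveʳ eq) = refl , refl
  ⊗ᵛ-injective-Normalized {y = _ ∷ _} {_ ∷ _} {ξ} {ξ′} (inj₁ (refl , _)) (inj₂ refl) _ nξ′ eq =
    contradiction (trans (sym (*ᵛ-identityˡ ξ′)) (trans (sym (Vec.∷-injectiveˡ eq)) (*ᵛ-zeroˡ ξ)))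
                  (Normalized⇒≢0ᵛ nξ′)
  ⊗ᵛ-injective-Normalized {y = _ ∷ _} {_ ∷ _} {ξ} {ξ′} (inj₂ refl) (inj₁ (refl , _)) nξ _ eq =
    contradiction (trans (sym (*ᵛ-identityˡ ξ)) (trans (Vec.∷-injectiveˡ eq) (*ᵛ-zeroˡ ξ′)))
                  (Normalized⇒≢0ᵛ nξ)
  ⊗ᵛ-injective-Normalized {y = _ ∷ y} {_ ∷ y′} {ξ} {ξ′} (inj₂ refl) (inj₂ refl) nξ _ eq
    with refl ← trans (sym (*ᵛ-identityˡ ξ)) (trans (Vec.∷-injectiveˡ eq) (*ᵛ-identityˡ ξ′)) =
    cong (1# ∷_) (rows-injective y y′ (Vec.∷-injectiveʳ eq)) , refl
    where
    rows-injective : ∀ {i} (u u′ : V i) → u ⊗ᵛ ξ ≡ u′ ⊗ᵛ ξ → u ≡ u′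
    rows-injective []      []        _   = refl
    rows-injective (x ∷ u) (x′ ∷ u′) eq′ =
      cong₂ _∷_ (*ᵛ-cancelʳ-Normalized ξ nξ (Vec.∷-injectiveˡ eq′))
                (rows-injective u u′ (Vec.∷-injectiveʳ eq′))

  scale-⊗ᵛ : ∀ {i k} c α β (y : V i) (ξ : V k) →
    Vec.map (c *ᵛ_) ((α *ᵛ y) ⊗ᵛ (β *ᵛ ξ)) ≡ Vec.map ((c * (α * β)) *ᵛ_) (y ⊗ᵛ ξ)
  scale-⊗ᵛ c α β []      ξ = refl
  scale-⊗ᵛ c α β (x ∷ y) ξ = cong₂ _∷_ row (scale-⊗ᵛ c α β y ξ)
    where
    row : c *ᵛ (α * x) *ᵛ β *ᵛ ξ ≡ (c * (α * β)) *ᵛ x *ᵛ ξ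
    row = begin
      c *ᵛ (α * x) *ᵛ β *ᵛ ξ
        ≡⟨ cong (c *ᵛ_) (*ᵛ-assoc (α * x) β ξ) ⟩
      c *ᵛ ((α * x) * β) *ᵛ ξ
        ≡⟨ *ᵛ-assoc c _ ξ ⟩
      (c * ((α * x) * β)) *ᵛ ξ
        ≡⟨ cong (_*ᵛ ξ) (solve 4 (λ c α x β → c :* ((α :* x) :* β) := (c :* (α :* β)) :* x) refl c α x β) ⟩
      ((c * (α * β)) * x) *ᵛ ξ
        ≡⟨ *ᵛ-assoc _ x ξ ⟨
      (c * (α * β)) *ᵛ x *ᵛ ξ ∎

  concat-scale : ∀ {i k} c (A : Vec (V k) i) → concat (Vec.map (c *ᵛ_) A) ≡ c *ᵛ concat A
  concat-scale c []      = refl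
  concat-scale c (r ∷ A) = trans (cong (c *ᵛ r Vec.++_) (concat-scale c A)) (sym (Vec.map-++ (c *_) r (concat A)))

  scale-identityˡ : ∀ {i k} (A : Vec (V k) i) → Vec.map (1# *ᵛ_) A ≡ A
  scale-identityˡ []      = refl
  scale-identityˡ (r ∷ A) = cong₂ _∷_ (*ᵛ-identityˡ r) (scale-identityˡ A)

  Normalized-scale-⊗ᵛ⇒≡ : ∀ {i k γ} {y : V i} {ξ : V k} → Normalized F y → Normalized F ξ →
    Normalized F (concat (Vec.map (γ *ᵛ_) (y ⊗ᵛ ξ))) → Vec.map (γ *ᵛ_) (y ⊗ᵛ ξ) ≡ y ⊗ᵛ ξ
  Normalized-scale-⊗ᵛ⇒≡ {γ = γ} {y} {ξ} ny nξ nX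
    with refl ← Normalized-*ᵛ⇒≡1 (concat (y ⊗ᵛ ξ)) (Normalized-concat-⊗ᵛ ny nξ)
                  (subst (Normalized F) (concat-scale γ (y ⊗ᵛ ξ)) nX) = scale-identityˡ (y ⊗ᵛ ξ)

  trace-outer : ∀ {k} (y ξ : V k) (M : Mat F k) → trace F (_⊗_ F (outer F y ξ) M) ≡ (_⟨_⟩ F ξ M) ∙ y
  trace-outer y ξ M = cong (sumV F) (begin
    Vec.tabulate (λ i → Vec.lookup (Vec.lookup (_⊗_ F (outer F y ξ) M) i) i)
      ≡⟨ Vec.tabulate-cong diagonal ⟩
    Vec.tabulate (λ i → Vec.lookup ξM i * Vec.lookup y i)
      ≡⟨ Vec.tabulate-cong (λ i → Vec.lookup-zipWith _*_ i ξM y) ⟨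
    Vec.tabulate (Vec.lookup (Vec.zipWith _*_ ξM y))
      ≡⟨ Vec.tabulate∘lookup _ ⟩
    Vec.zipWith _*_ ξM y ∎)
    where
    ξM : V _
    ξM = _⟨_⟩ F ξ M
    diagonal : ∀ i → Vec.lookup (Vec.lookup (_⊗_ F (outer F y ξ) M) i) i ≡ Vec.lookup ξM i * Vec.lookup y i
    diagonal i = begin
      Vec.lookup (Vec.lookup (_⊗_ F (outer F y ξ) M) i) i
        ≡⟨ cong (λ r → Vec.lookup r i) (Vec.lookup-map i _ (outer F y ξ)) ⟩
      Vec.lookup (Vec.tabulate (λ j → Vec.lookup (outer F y ξ) i ∙ column F M j)) i
        ≡⟨ Vec.lookup∘tabulate _ i ⟩
      Vec.lookup (outer F y ξ) i ∙ column F M i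
        ≡⟨ cong (_∙ column F M i) (Vec.lookup-map i _ y) ⟩
      (Vec.lookup y i *ᵛ ξ) ∙ column F M i
        ≡⟨ ∙-*ᵛˡ (Vec.lookup y i) ξ (column F M i) ⟩
      Vec.lookup y i * (ξ ∙ column F M i)
        ≡⟨ *-comm _ _ ⟩
      (ξ ∙ column F M i) * Vec.lookup y i
        ≡⟨ cong (_* Vec.lookup y i) (Vec.lookup∘tabulate _ i) ⟨
      Vec.lookup ξM i * Vec.lookup y i ∎

module Semilinear (F : FiniteField) (Aut : Automorphism F) where
  open Field F
  open Vectors F
  open RankOne F
  open FiniteField F using (Carrier; _≟_)
  open Automorphism Aut
  open ≡-Reasoning

  σᵛ : ∀ {k} → V k → V k
  σᵛ = _^σ F Aut

  σ-0 : σ 0# ≡ 0#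
  σ-0 = x+x≈x⇒x≈0 (σ 0#) (trans (sym (σ-+ 0# 0#)) (cong σ (+-identityʳ 0#)))

  σ-injective : ∀ {a b} → σ a ≡ σ b → a ≡ b
  σ-injective {a} {b} σa≡σb = trans (sym (σ⁻¹-σ a)) (trans (cong σ⁻¹ σa≡σb) (σ⁻¹-σ b))

  σ-≢0 : ∀ {a} → a ≢ 0# → σ a ≢ 0#
  σ-≢0 a≢0 σa≡0 = a≢0 (σ-injective (trans σa≡0 (sym σ-0)))

  σ-∙ : ∀ {k} (ξ x : V k) → σ (ξ ∙ x) ≡ σᵛ ξ ∙ σᵛ x
  σ-∙ []      []      = σ-0
  σ-∙ (a ∷ ξ) (b ∷ x) = trans (σ-+ _ _) (cong₂ _+_ (σ-* a b) (σ-∙ ξ x))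

  σᵛ-*ᵛ : ∀ {k} c (v : V k) → σᵛ (c *ᵛ v) ≡ σ c *ᵛ σᵛ v
  σᵛ-*ᵛ c []      = refl
  σᵛ-*ᵛ c (x ∷ v) = cong₂ _∷_ (σ-* c x) (σᵛ-*ᵛ c v)

  σᵛ-σ⁻¹ : ∀ {k} (y : V k) → σᵛ (Vec.map σ⁻¹ y) ≡ y
  σᵛ-σ⁻¹ y = trans (sym (Vec.map-∘ σ σ⁻¹ y)) (trans (Vec.map-cong σ-σ⁻¹ y) (Vec.map-id y))

  σ⁻¹-σᵛ : ∀ {k} (x : V k) → Vec.map σ⁻¹ (σᵛ x) ≡ x
  σ⁻¹-σᵛ x = trans (sym (Vec.map-∘ σ⁻¹ σ x)) (trans (Vec.map-cong σ⁻¹-σ x) (Vec.map-id x))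

  σᵛ-injective : ∀ {k} {x x′ : V k} → σᵛ x ≡ σᵛ x′ → x ≡ x′
  σᵛ-injective {x = x} {x′} eq = trans (sym (σ⁻¹-σᵛ x)) (trans (cong (Vec.map σ⁻¹) eq) (σ⁻¹-σᵛ x′))

  σᵛ-0ᵛ : ∀ {k} → σᵛ (0ᵛ {k}) ≡ 0ᵛ
  σᵛ-0ᵛ {k} = trans (Vec.map-replicate σ 0# k) (cong (Vec.replicate k) σ-0)

  σᵛ-≢0ᵛ : ∀ {k} {x : V k} → x ≢ 0ᵛ → σᵛ x ≢ 0ᵛ
  σᵛ-≢0ᵛ x≢0 σx≡0 = x≢0 (σᵛ-injective (trans σx≡0 (sym σᵛ-0ᵛ)))

  Normalized-σᵛ : ∀ {k} {v : V k} → Normalized F v → Normalized F (σᵛ v)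
  Normalized-σᵛ {v = _ ∷ v} (inj₁ (refl , n)) = inj₁ (σ-0 , Normalized-σᵛ n)
  Normalized-σᵛ {v = _ ∷ v} (inj₂ refl)       = inj₂ σ-1

  ¬KerCond⇒∃ : ∀ {k} (M : Mat F k) (ξ : V k) → ¬ KerCond F Aut M ξ →
    ∃[ y ] σᵛ ξ ∙ y ≡ 0# × _⟨_⟩ F ξ M ∙ y ≢ 0#
  ¬KerCond⇒∃ M ξ ¬K with ∃? F _ (λ y → ((σᵛ ξ ∙ y) ≟ 0#) ×-dec nonzero? (_⟨_⟩ F ξ M ∙ y))
  ... | yes witness = witness
  ... | no  ∄y      = contradiction (λ y σξ∙y≡0 →
    decidable-stable ((_⟨_⟩ F ξ M ∙ y) ≟ 0#) (λ ξM∙y≢0 → ∄y (y , σξ∙y≡0 , ξM∙y≢0))) ¬K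

  ΛPoint-outer : ∀ {k} {ξ y : V k} → Normalized F ξ → Normalized F y → σᵛ ξ ∙ y ≡ 0# →
    ΛPoint F Aut (outer F y ξ)
  ΛPoint-outer {ξ = ξ} {y} nξ ny σξ∙y≡0 =
    Normalized-concat-⊗ᵛ ny nξ ,
    x , ξ , x≢0 , Normalized⇒≢0ᵛ nξ , ξ∙x≡0 , 1# , 1≢0 ,
    sym (trans (scale-identityˡ _) (cong (_⊗ᵛ ξ) (σᵛ-σ⁻¹ y)))
    where
    x : V _
    x = Vec.map σ⁻¹ y
    x≢0 : x ≢ 0ᵛ
    x≢0 x≡0 = Normalized⇒≢0ᵛ ny (trans (sym (σᵛ-σ⁻¹ y)) (trans (cong σᵛ x≡0) σᵛ-0ᵛ))
    ξ∙x≡0 : ξ ∙ x ≡ 0#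
    ξ∙x≡0 = σ-injective (begin
      σ (ξ ∙ x)      ≡⟨ σ-∙ ξ x ⟩
      σᵛ ξ ∙ σᵛ x    ≡⟨ cong (σᵛ ξ ∙_) (σᵛ-σ⁻¹ y) ⟩
      σᵛ ξ ∙ y       ≡⟨ σξ∙y≡0 ⟩
      0#             ≡⟨ σ-0 ⟨
      σ 0#           ∎)

  -- Normalize x^σ and ξ; the normalization of X forces the product of all scalars to be 1.
  ΛPoint⇒outer : ∀ {k} {X : Mat F k} → ΛPoint F Aut X →
    ∃[ ξ ] ∃[ y ] Normalized F ξ × Normalized F y × σᵛ ξ ∙ y ≡ 0# × outer F y ξ ≡ X
  ΛPoint⇒outer (nX , x , ξ , x≢0 , ξ≢0 , ξ∙x≡0 , c , c≢0 , refl)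
    with α , y , α≢0 , ny , σx≡αy ← normalize (σᵛ x) (σᵛ-≢0ᵛ x≢0)
       | β , ξ′ , β≢0 , nξ′ , refl ← normalize ξ ξ≢0 =
    ξ′ , y , nξ′ , ny , σξ′∙y≡0 ,
    sym (trans X≡scaled (Normalized-scale-⊗ᵛ⇒≡ ny nξ′ (subst (Normalized F) (cong concat X≡scaled) nX)))
    where
    X≡scaled : Vec.map (c *ᵛ_) (σᵛ x ⊗ᵛ (β *ᵛ ξ′)) ≡ Vec.map ((c * (α * β)) *ᵛ_) (y ⊗ᵛ ξ′)
    X≡scaled = trans (cong (λ z → Vec.map (c *ᵛ_) (z ⊗ᵛ (β *ᵛ ξ′))) σx≡αy) (scale-⊗ᵛ c α β y ξ′)
    σξ′∙y≡0 : σᵛ ξ′ ∙ y ≡ 0#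
    σξ′∙y≡0 = *≡0⇒≡0 α≢0 (*≡0⇒≡0 (σ-≢0 β≢0) (begin
      σ β * (α * (σᵛ ξ′ ∙ y))     ≡⟨ cong (σ β *_) (∙-*ᵛʳ α (σᵛ ξ′) y) ⟨
      σ β * (σᵛ ξ′ ∙ (α *ᵛ y))    ≡⟨ ∙-*ᵛˡ (σ β) (σᵛ ξ′) (α *ᵛ y) ⟨
      (σ β *ᵛ σᵛ ξ′) ∙ (α *ᵛ y)   ≡⟨ cong₂ _∙_ (σᵛ-*ᵛ β ξ′) σx≡αy ⟨
      σᵛ (β *ᵛ ξ′) ∙ σᵛ x         ≡⟨ σ-∙ (β *ᵛ ξ′) x ⟨
      σ ((β *ᵛ ξ′) ∙ x)           ≡⟨ cong σ ξ∙x≡0 ⟩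
      σ 0#                        ≡⟨ σ-0 ⟩
      0#                          ∎))

module CodewordWeight (F : FiniteField) (Aut : Automorphism F) (m : ℕ) (M : Mat F (2 ℕ.+ m)) where
  open Counting
  open Field F
  open Vectors F
  open Enumeration F
  open AffinePoints F
  open RankOne F
  open Semilinear F Aut
  open FiniteField F using (Carrier; _≟_; size)
  open ≡-Reasoning

  n k : ℕ
  n = suc m
  k = suc n

  _⟨M⟩ : V k → V k
  ξ ⟨M⟩ = _⟨_⟩ F ξ M

  tr : Mat F k → Carrier
  tr X = trace F (_⊗_ F X M)

  Supported : V k × V k → Set
  Supported (ξ , y) = Normalized F ξ × Normalized F y × σᵛ ξ ∙ y ≡ 0# × ξ ⟨M⟩ ∙ y ≢ 0#

  supported? : ∀ p → Dec (Supported p)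
  supported? (ξ , y) =
    normalized? F ξ ×-dec normalized? F y ×-dec ((σᵛ ξ ∙ y) ≟ 0#) ×-dec nonzero? (ξ ⟨M⟩ ∙ y)

  support : List (V k × V k)
  support = filter supported? (cartesianProduct (allVecs F k) (allVecs F k))

  weight≡length-support : weight F Aut (codeword F Aut n M) ≡ length support
  weight≡length-support = begin
    weight F Aut (codeword F Aut n M)
      ≡⟨ length-filter-map nonzero? tr (Λpoints F Aut n) ⟩
    length nonzeroTrace
      ≡⟨ bijection⇒length≡ (Unique.filter⁺ _ (Unique.cartesianProduct⁺ (allVecs-unique k) (allVecs-unique k)))
                           (Unique.filter⁺ _ (Unique.filter⁺ _ (allMats-unique k)))
                           (λ (ξ , y) → outer F y ξ) into inj onto ⟨
    length support ∎
    where
    nonzeroTrace : List (Mat F k)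
    nonzeroTrace = filter (nonzero? ∘ tr) (Λpoints F Aut n)
    supported : ∀ {p} → p ∈ support → Supported p
    supported p∈ = proj₂ (∈-filter⁻ supported? {xs = cartesianProduct (allVecs F k) (allVecs F k)} p∈)
    into : ∀ {p} → p ∈ support → outer F (proj₂ p) (proj₁ p) ∈ nonzeroTrace
    into {ξ , y} p∈ with nξ , ny , σξ∙y≡0 , ξM∙y≢0 ← supported p∈ =
      ∈-filter⁺ _ (∈-filter⁺ _ (allMats-complete F _) (ΛPoint-outer nξ ny σξ∙y≡0))
                (ξM∙y≢0 ∘ trans (sym (trace-outer y ξ M)))
    inj : ∀ {p p′} → p ∈ support → p′ ∈ support →
          outer F (proj₂ p) (proj₁ p) ≡ outer F (proj₂ p′) (proj₁ p′) → p ≡ p′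
    inj {ξ , y} {ξ′ , y′} p∈ p′∈ eq with nξ , ny , _ ← supported p∈ | nξ′ , ny′ , _ ← supported p′∈
      with refl , refl ← ⊗ᵛ-injective-Normalized ny ny′ nξ nξ′ eq = refl
    onto : ∀ {X} → X ∈ nonzeroTrace → ∃[ p ] p ∈ support × outer F (proj₂ p) (proj₁ p) ≡ X
    onto {X} X∈
      with X∈Λ , trX≢0 ← ∈-filter⁻ _ {xs = Λpoints F Aut n} X∈
      with ξ , y , nξ , ny , σξ∙y≡0 , refl ← ΛPoint⇒outer (proj₂ (∈-filter⁻ _ {xs = allMats F k} X∈Λ)) =
      (ξ , y) ,
      ∈-filter⁺ supported? (∈-cartesianProduct⁺ (allVecs-complete F ξ) (allVecs-complete F y))
                (nξ , ny , σξ∙y≡0 , trX≢0 ∘ trans (trace-outer y ξ M)) ,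
      refl

  Contributes : V k → Set
  Contributes ξ = Normalized F ξ × ¬ KerCond F Aut M ξ

  contributes? : ∀ ξ → Dec (Contributes ξ)
  contributes? ξ = normalized? F ξ ×-dec ¬? (kerCond? F Aut M ξ)

  length-support-fibre : ∀ ξ → Contributes ξ → length (filter (supported? ∘ (ξ ,_)) (allVecs F k)) ≡ size ^ m
  length-support-fibre ξ (nξ , ¬K) with y₀ , σξ∙y₀≡0 , ξM∙y₀≢0 ← ¬KerCond⇒∃ M ξ ¬K = begin
    length (filter (supported? ∘ (ξ ,_)) (allVecs F k))
      ≡⟨ cong length (List.filter-≐ _ (affinePoint? (σᵛ ξ) (ξ ⟨M⟩)) (proj₂ , (nξ ,_)) (allVecs F k)) ⟩
    length (affinePoints (σᵛ ξ) (ξ ⟨M⟩))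
      ≡⟨ length-affinePoints {b = ξ ⟨M⟩} (Normalized-σᵛ nξ) σξ∙y₀≡0 ξM∙y₀≢0 ⟩
    size ^ m ∎

  length-support-fibre-¬Contributes : ∀ ξ → ¬ Contributes ξ →
    length (filter (supported? ∘ (ξ ,_)) (allVecs F k)) ≡ 0
  length-support-fibre-¬Contributes ξ ¬contributes =
    cong length (List.filter-none _ (All.universal unsupported (allVecs F k)))
    where
    unsupported : ∀ y → ¬ Supported (ξ , y)
    unsupported y (nξ , _ , σξ∙y≡0 , ξM∙y≢0) = ¬contributes (nξ , λ K → ξM∙y≢0 (K y σξ∙y≡0))

  weight-codeword : weight F Aut (codeword F Aut n M) ≡ weightFormula F n (θ F Aut n M)
  weight-codeword = begin
    weight F Aut (codeword F Aut n M)
      ≡⟨ weight≡length-support ⟩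
    length support
      ≡⟨ length-filter-cartesianProduct contributes? supported? (allVecs F k) (size ^ m)
           length-support-fibre length-support-fibre-¬Contributes (allVecs F k) ⟩
    size ^ m ℕ.* #contributing
      ≡⟨ cong (size ^ m ℕ.*_) #contributing≡#points∸θM ⟩
    size ^ m ℕ.* (length (points k) ∸ θM)
      ≡⟨ ℕ.*-distribˡ-∸ (size ^ m) (length (points k)) θM ⟩
    size ^ m ℕ.* length (points k) ∸ size ^ m ℕ.* θM
      ≡⟨ cong (λ p → size ^ m ℕ.* p ∸ size ^ m ℕ.* θM) (length-points k) ⟩
    weightFormula F n θM ∎
    where
    θM #contributing : ℕ
    θM = θ F Aut n M
    #contributing = length (filter contributes? (allVecs F k))
    #contributing≡#points∸θM : #contributing ≡ length (points k) ∸ θM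
    #contributing≡#points∸θM = sym (trans
      (cong (_∸ θM) (length-filter-split (normalized? F) (kerCond? F Aut M) (allVecs F k)))
      (ℕ.m+n∸m≡n θM #contributing))

corollary3p4 : (F : FiniteField) (Aut : Automorphism F) (n : ℕ) → 1 ≤ n →
    ((M : Mat F (suc n)) →
        weight F Aut (codeword F Aut n M) ≡ weightFormula F n (θ F Aut n M))
    × ((w : ℕ) →
        (Σ[ M ∈ Mat F (suc n) ] weight F Aut (codeword F Aut n M) ≡ w)
        ⇔ (Σ[ M ∈ Mat F (suc n) ] w ≡ weightFormula F n (θ F Aut n M)))
corollary3p4 F Aut (suc m) _ =
  weight-codeword , λ w → mk⇔ (λ (M , eq) → M , trans (sym eq) (weight-codeword M))
                              (λ (M , eq) → M , trans (weight-codeword M) (sym eq))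
  where
  weight-codeword : (M : Mat F (2 ℕ.+ m)) →
    weight F Aut (codeword F Aut (suc m) M) ≡ weightFormula F (suc m) (θ F Aut (suc m) M)
  weight-codeword = CodewordWeight.weight-codeword F Aut m
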